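{- Define $\tau_0,\tau_1:\mathbb{Z}^2\to\mathbb{Z}^2$ by $\tau_0[a,b]=[a,a+b]$ and $\tau_1[a,b]=[b,a+b]$. For a binary code $\mathbf{c}=x_1x_2\cdots x_n$ with each $x_i\in\{0,1\}$, set $T[\mathbf{c}]=\tau_{x_n}\tau_{x_{n-1}}\cdots\tau_{x_1}[1,2]$, so that $\tau_{x_1}$ is applied first. Let $\mathrm{refl}(\mathbf{c})=x_nx_{n-1}\cdots x_1$. Then for every binary code $\mathbf{c}$, \[\|T[\mathbf{c}]\| = \|T[\mathrm{refl}(\mathbf{c})]\|,\] where $\|[a,b]\|=|a|+|b|$.
   Context: All pairs $T[\mathbf{c}]$ have positive entries, so $\|T[\mathbf{c}]\|$ is the sum of the two entries. -}

module Defs where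

open import Data.Integer using (ℤ; _+_; ∣_∣; +_)
open import Data.Nat using (ℕ) renaming (_+_ to _+ℕ_)
open import Data.Fin using (Fin; zero; suc)
open import Data.Product using (_×_; _,_)
open import Data.List using (List; []; _∷_; reverse)

Bit : Set
Bit = Fin 2

τ : Bit → ℤ × ℤ → ℤ × ℤ
τ zero    (a , b) = (a , a + b)
τ (suc _) (a , b) = (b , a + b)

applyCode : List Bit → ℤ × ℤ → ℤ × ℤ
applyCode []       v = v
applyCode (x ∷ xs) v = applyCode xs (τ x v)

T : List Bit → ℤ × ℤ
T c = applyCode c (+ 1 , + 2)

refl-code : List Bit → List Bit
refl-code = reverse

‖_‖ : ℤ × ℤ → ℕ
‖ (a , b) ‖ = ∣ a ∣ +ℕ ∣ b ∣

{-# OPTIONS --safe #-}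
module Submission where

-- Both τ₀ and τ₁ are linear, and the sum of the entries of a pair p is u · p with u = [1,1].
-- The matrix of τ₁ is symmetric and conjugates each transpose τₘᵀ into τₘ (τ₁ τₘᵀ = τₘ τ₁),
-- so moving the maps of the reflected code across the dot product one at a time gives
-- x · T_refl(c)(τ₁ y) = y · T_c(τ₁ x). Since [1,2] = τ₁ [1,1], taking x = y = [1,1]
-- shows that T[c] and T[refl(c)] have the same entry sum. Positivity turns that sum into the norm.

open import Defs
open import Data.List using (List; []; _∷_; reverse; _++_; [_])
open import Data.List.Properties using (reverse-++)
open import Data.Integer using (ℤ; _+_; _*_; +_)
open import Data.Integer.Properties using (+-injective; *-identityˡ)
open import Data.Integer.Tactic.RingSolver using (solve-∀)
open import Data.Nat using () renaming (_+_ to _+ℕ_)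
open import Data.Fin using (zero; suc)
open import Data.Product using (_×_; _,_; ∃₂)
open import Relation.Binary.PropositionalEquality hiding ([_])
open ≡-Reasoning

infix 7 _·_

_·_ : ℤ × ℤ → ℤ × ℤ → ℤ
(a , b) · (c , d) = a * c + b * d

τ₁ : ℤ × ℤ → ℤ × ℤ
τ₁ = τ (suc zero)

τᵀ : Bit → ℤ × ℤ → ℤ × ℤ
τᵀ zero    (a , b) = (a + b , b)
τᵀ (suc _) (a , b) = (b , a + b)

·-τ-adjoint : ∀ m x z → x · τ m z ≡ τᵀ m x · z
·-τ-adjoint zero    (a , b) (c , d) = ring a b c d
  where
  ring : ∀ a b c d → a * c + b * (c + d) ≡ (a + b) * c + b * d
  ring = solve-∀
·-τ-adjoint (suc _) (a , b) (c , d) = ring a b c d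
  where
  ring : ∀ a b c d → a * d + b * (c + d) ≡ b * c + (a + b) * d
  ring = solve-∀

·-τ₁-sym : ∀ x y → x · τ₁ y ≡ y · τ₁ x
·-τ₁-sym (a , b) (c , d) = ring a b c d
  where
  ring : ∀ a b c d → a * d + b * (c + d) ≡ c * b + d * (a + b)
  ring = solve-∀

τ₁-τᵀ-intertwine : ∀ m x → τ₁ (τᵀ m x) ≡ τ m (τ₁ x)
τ₁-τᵀ-intertwine zero    (a , b) = cong (b ,_) (ring a b)
  where
  ring : ∀ a b → a + b + b ≡ b + (a + b)
  ring = solve-∀
τ₁-τᵀ-intertwine (suc _) (a , b) = refl

applyCode-++ : ∀ xs ys v → applyCode (xs ++ ys) v ≡ applyCode ys (applyCode xs v)
applyCode-++ []       ys v = refl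
applyCode-++ (x ∷ xs) ys v = applyCode-++ xs ys (τ x v)

applyCode-reverse-∷ : ∀ m ws v → applyCode (reverse (m ∷ ws)) v ≡ τ m (applyCode (reverse ws) v)
applyCode-reverse-∷ m ws v = begin
  applyCode (reverse (m ∷ ws)) v  ≡⟨ cong (λ l → applyCode l v) (reverse-++ [ m ] ws) ⟩
  applyCode (reverse ws ++ [ m ]) v ≡⟨ applyCode-++ (reverse ws) [ m ] v ⟩
  τ m (applyCode (reverse ws) v)  ∎

·-applyCode-reverse : ∀ w x y → x · applyCode (reverse w) (τ₁ y) ≡ y · applyCode w (τ₁ x)
·-applyCode-reverse []       x y = ·-τ₁-sym x y
·-applyCode-reverse (m ∷ ws) x y = begin
  x · applyCode (reverse (m ∷ ws)) (τ₁ y) ≡⟨ cong (x ·_) (applyCode-reverse-∷ m ws (τ₁ y)) ⟩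
  x · τ m (applyCode (reverse ws) (τ₁ y)) ≡⟨ ·-τ-adjoint m x _ ⟩
  τᵀ m x · applyCode (reverse ws) (τ₁ y)  ≡⟨ ·-applyCode-reverse ws (τᵀ m x) y ⟩
  y · applyCode ws (τ₁ (τᵀ m x))          ≡⟨ cong (λ z → y · applyCode ws z) (τ₁-τᵀ-intertwine m x) ⟩
  y · applyCode ws (τ m (τ₁ x))           ∎

applyCode-ℕ : ∀ w n m → ∃₂ λ n′ m′ → applyCode w (+ n , + m) ≡ (+ n′ , + m′)
applyCode-ℕ []          n m = n , m , refl
applyCode-ℕ (zero ∷ w)  n m = applyCode-ℕ w n (n +ℕ m)
applyCode-ℕ (suc _ ∷ w) n m = applyCode-ℕ w m (n +ℕ m)

‖T‖≡entry-sum : ∀ w → + ‖ T w ‖ ≡ (+ 1 , + 1) · T w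
‖T‖≡entry-sum w with applyCode-ℕ w 1 2
... | n , m , eq rewrite eq = sym (cong₂ _+_ (*-identityˡ (+ n)) (*-identityˡ (+ m)))

theorem3p4 : (c : List Bit) → ‖ T c ‖ ≡ ‖ T (refl-code c) ‖
theorem3p4 c = +-injective (begin
  + ‖ T c ‖           ≡⟨ ‖T‖≡entry-sum c ⟩
  u · T c             ≡⟨ ·-applyCode-reverse c u u ⟨
  u · T (reverse c)   ≡⟨ ‖T‖≡entry-sum (reverse c) ⟨
  + ‖ T (reverse c) ‖ ∎)
  where
  u : ℤ × ℤ
  u = + 1 , + 1
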